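{- For $\theta>0$, integers $N\ge1$ and $0\le k\le N$, let $W(N,k)=\sum_{\pi}\theta^{\mathrm{lrm}(\pi)}$, the sum over $k$-winnable $\pi\in\mathfrak{S}_N$. Then $W(1,0)=\theta$, $W(N,N)=0$, and for $N\ge2$ and $0\le k\le N-1$, $$W(N,k)=(N-1)W(N-1,k)+\frac{(N-2)!}{(k-1)!}\,\theta\,[\theta]_k,$$ where the second term is interpreted as $0$ when $k=0$.
   Context: $\mathrm{lrm}(\pi)$ is the number of left-to-right maxima of $\pi\in\mathfrak{S}_N$ (entries $\pi_j$ larger than all $\pi_i$ with $i<j$). $[\theta]_k=\theta(\theta+1)\cdots(\theta+k-1)$, with $[\theta]_0=1$. A permutation $\pi\in\mathfrak{S}_N$ is $k$-winnable if the positional strategy that rejects the first $k$ entries and accepts the first subsequent entry that is a left-to-right maximum selects the entry $N$; equivalently, $N$ occurs in a position $j>k$ and no position in $k+1,\dots,j-1$ holds a left-to-right maximum.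
   Formalization: The parameter θ ranges over the positive rationals instead of the positive reals. -}

module Defs where

open import Data.Nat as ℕ using (ℕ; zero; suc; _<ᵇ_; _!; _∸_)
open import Data.Nat.Properties using (_!≢0)
open import Data.Fin using (Fin; toℕ)
open import Data.Bool using (Bool; true; false; if_then_else_)
open import Data.Maybe using (Maybe; just; nothing)
open import Data.List using (List; []; _∷_; map; concatMap; filter; foldr; drop)
open import Data.List.Relation.Unary.Unique.Propositional using (Unique)
open import Data.List.Relation.Unary.Unique.DecPropositional using (unique?)
open import Data.Fin.Properties using () renaming (_≟_ to _≟F_)
open import Data.Maybe.Properties using (≡-dec)
open import Data.Nat.Properties using () renaming (_≟_ to _≟ℕ_)
open import Data.Integer using (+_)
open import Data.Rational using (ℚ; 0ℚ; 1ℚ; _+_; _*_; _/_)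
open import Data.Product using (_×_; _,_)
open import Relation.Nullary using (Dec)
open import Data.List using (allFin)
open import Relation.Binary.PropositionalEquality using (_≡_)

-- A permutation of {1,…,N} is represented in one-line notation as the
-- list π = [π₁,…,π_N] of its values.  We enumerate all lists of
-- length n over Fin N and keep the ones without repetition; for n = N
-- these are exactly the bijections Fin N → Fin N.

allLists : (N : ℕ) → ℕ → List (List (Fin N))
allLists N zero    = [] ∷ []
allLists N (suc n) = concatMap (λ xs → map (λ i → i ∷ xs) (allFin N)) (allLists N n)

oneLine : ∀ {N} → List (Fin N) → List ℕ
oneLine = map (λ i → suc (toℕ i))

𝔖 : ℕ → List (List ℕ)
𝔖 N = map oneLine (filter (unique? _≟F_) (allLists N N))

lrmFlags : ℕ → List ℕ → List Bool
lrmFlags m []       = []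
lrmFlags m (x ∷ xs) = if m <ᵇ x then true ∷ lrmFlags x xs else false ∷ lrmFlags m xs

-- number of left-to-right maxima (entries are ≥ 1, so starting from 0 is correct)
lrm : List ℕ → ℕ
lrm π = foldr (λ b n → if b then suc n else n) 0 (lrmFlags 0 π)

-- The positional strategy with threshold k: reject the first k entries,
-- accept the first subsequent entry that is a left-to-right maximum.

firstFlagged : List ℕ → List Bool → Maybe ℕ
firstFlagged (x ∷ xs) (true  ∷ bs) = just x
firstFlagged (x ∷ xs) (false ∷ bs) = firstFlagged xs bs
firstFlagged _        _            = nothing

strategy : ℕ → List ℕ → Maybe ℕ
strategy k π = firstFlagged (drop k π) (drop k (lrmFlags 0 π))

Winnable : ℕ → ℕ → List ℕ → Set
Winnable N k π = strategy k π ≡ just N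

winnable? : ∀ N k π → Dec (Winnable N k π)
winnable? N k π = ≡-dec _≟ℕ_ (strategy k π) (just N)

_^ℚ_ : ℚ → ℕ → ℚ
x ^ℚ zero  = 1ℚ
x ^ℚ suc n = x * (x ^ℚ n)

rising : ℚ → ℕ → ℚ
rising θ zero    = 1ℚ
rising θ (suc k) = rising θ k * (θ + ((+ k) / 1))

ℕtoℚ : ℕ → ℚ
ℕtoℚ n = (+ n) / 1

sumℚ : List ℚ → ℚ
sumℚ = foldr _+_ 0ℚ

factRatio : ℕ → ℕ → ℚ
factRatio a b = (+ (a !)) / (b !)
  where instance _ = b !≢0

W : ℚ → ℕ → ℕ → ℚ
W θ N k = sumℚ (map (λ π → θ ^ℚ lrm π) (filter (winnable? N k) (𝔖 N)))

{-# OPTIONS --safe #-}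

-- Write π ∈ 𝔖 (n + 1) as σ ∈ 𝔖 n with its values ≥ v raised by one and v appended. If v ≤ n, the entry
-- n + 1 comes before v, so v is not a left-to-right maximum: the strategy behaves on π as on σ (selecting
-- n + 1 in π exactly when it selects n in σ) and lrm π = lrm σ, so these n choices of v contribute
-- n·W(n,k). If v = n + 1, it is a new left-to-right maximum, lrm π = lrm σ + 1, and for k ≤ n the strategy
-- selects it exactly when it selects nothing in σ; this contributes θ·A(n,k), where A(n,k) is the θ^lrm
-- weight of the σ ∈ 𝔖 n on which the strategy selects nothing. The same decomposition gives
-- A(n+1,k) = n·A(n,k) for k ≤ n, while A(k,k) is the total weight T(k) of 𝔖 k, and T(n+1) = (n+θ)·T(n)
-- gives T(k) = [θ]_k. Hence A(n,k) = (n-1)!/(k-1)!·[θ]_k for n ≥ k ≥ 1, and A(n,0) = 0 for n ≥ 1.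
module Submission where

open import Defs
open import Data.Nat using (ℕ; suc; _≤_; _<_; _∸_; _!)
open import Data.Rational using (ℚ; 0ℚ; _+_; _*_)
open import Data.Product using (_×_)
open import Relation.Binary.PropositionalEquality using (_≡_)

open import Data.Bool using (Bool; true; false; if_then_else_; T)
open import Data.Empty using (⊥-elim)
open import Data.Fin using (Fin; toℕ; fromℕ<)
import Data.Fin.Properties as Fin
open import Data.Integer as ℤ using (+_)
import Data.Integer.Properties as ℤ
open import Data.Integer.Solver using (module +-*-Solver)
open import Data.List
  using (List; []; _∷_; _++_; _∷ʳ_; [_]; map; concatMap; filter; drop; length; foldr; allFin; applyUpTo;
         cartesianProductWith; initLast; _∷ʳ′_)
import Data.List.Properties as List
open import Data.List.Membership.Propositional using (_∈_)
open import Data.List.Membership.Propositional.Properties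
  using (∈-map⁺; ∈-map⁻; ∈-filter⁺; ∈-filter⁻; ∈-allFin; ∈-applyUpTo⁺; ∈-applyUpTo⁻; ∈-++⁺ˡ; ∈-++⁺ʳ;
         ∈-cartesianProductWith⁺; ∈-cartesianProductWith⁻)
open import Data.List.Membership.Propositional.Properties.WithK using (unique∧set⇒bag)
open import Data.List.Relation.Binary.BagAndSetEquality using (∼bag⇒↭)
open import Data.List.Relation.Binary.Permutation.Propositional using (_↭_; ↭⇒↭ₛ)
import Data.List.Relation.Binary.Permutation.Propositional.Properties as ↭
open import Data.List.Relation.Binary.Permutation.Setoid.Properties using (foldr-commMonoid)
open import Data.List.Relation.Unary.All as All using (All; []; _∷_)
import Data.List.Relation.Unary.All.Properties as All
open import Data.List.Relation.Unary.AllPairs using ([]; _∷_)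
open import Data.List.Relation.Unary.Any using (here; there)
open import Data.List.Relation.Unary.Unique.DecPropositional using (unique?)
open import Data.List.Relation.Unary.Unique.Propositional using (Unique)
import Data.List.Relation.Unary.Unique.Propositional.Properties as Unique
open import Data.Maybe as Maybe using (Maybe; just; nothing; _<∣>_; is-nothing)
import Data.Maybe.Properties as Maybe
open import Data.Nat.Base as ℕ using (zero; z≤n; s≤s; _<ᵇ_; _≤′_; ≤′-refl; ≤′-step)
open import Data.Nat.Properties as ℕ using (_!≢0; _≟_)
open import Data.Product using (∃₂; _,_; proj₂; swap)
open import Data.Rational using (1ℚ; _/_; toℚᵘ)
import Data.Rational.Properties as ℚ
open import Data.Rational.Unnormalised as ℚᵘ using (mkℚᵘ; *≡*; _≃_)
import Data.Rational.Unnormalised.Properties as ℚᵘ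
open import Data.Sum using (inj₁; inj₂)
open import Data.Unit using (tt)
open import Function using (_∘_; flip; Injective)
open import Function.Bundles using (mk⇔)
open import Level using (0ℓ)
open import Relation.Binary.Definitions using (tri<; tri≈; tri>)
import Relation.Binary.PropositionalEquality as ≡
open ≡ using (_≢_; refl; sym; trans; cong; cong₂; subst; module ≡-Reasoning)
open import Relation.Nullary using (¬_; does; ofʸ; ofⁿ)
open import Relation.Nullary.Decidable using (does-⇔; dec-true; dec-false)
open import Relation.Unary using (Pred; Decidable)

-- Identities between quotients are proved in ℚᵘ, where _/_ does not normalise and ≃ is cross-multiplication.
toℚᵘ-/ : ∀ i n .{{_ : ℕ.NonZero n}} → toℚᵘ (i / n) ≃ mkℚᵘ i (ℕ.pred n)
toℚᵘ-/ i n = ℚᵘ.≃-trans (ℚᵘ.≃-reflexive (cong toℚᵘ (ℚ./-cong {i} refl (sym (ℕ.suc-pred n)))))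
                        (ℚ.toℚᵘ-fromℚᵘ (mkℚᵘ i (ℕ.pred n)))

ℕtoℚ-suc : ∀ n → ℕtoℚ (suc n) ≡ 1ℚ + ℕtoℚ n
ℕtoℚ-suc n = ℚ.toℚᵘ-injective (begin
  toℚᵘ (ℕtoℚ (suc n))              ≈⟨ toℚᵘ-/ (+ suc n) 1 ⟩
  mkℚᵘ (+ suc n) 0                  ≈⟨ *≡* (solve 1 (λ x → (con (+ 1) :+ x) :* con (+ 1)
                                         := (con (+ 1) :* con (+ 1) :+ x :* con (+ 1)) :* con (+ 1)) refl (+ n)) ⟩
  mkℚᵘ (+ 1) 0 ℚᵘ.+ mkℚᵘ (+ n) 0   ≈⟨ ℚᵘ.+-cong (toℚᵘ-/ (+ 1) 1) (toℚᵘ-/ (+ n) 1) ⟨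
  toℚᵘ 1ℚ ℚᵘ.+ toℚᵘ (ℕtoℚ n)       ≈⟨ ℚ.toℚᵘ-homo-+ 1ℚ (ℕtoℚ n) ⟨
  toℚᵘ (1ℚ + ℕtoℚ n)               ∎)
  where open ℚᵘ.≃-Reasoning
        open +-*-Solver

factRatio-self : ∀ m → factRatio m m ≡ 1ℚ
factRatio-self m = ℚ.toℚᵘ-injective (begin
  toℚᵘ (factRatio m m)              ≈⟨ toℚᵘ-/ (+ (m !)) (m !) ⟩
  mkℚᵘ (+ (m !)) (ℕ.pred (m !))     ≈⟨ *≡* (trans (ℤ.*-identityʳ (+ (m !)))
                                          (sym (trans (ℤ.*-identityˡ _) (cong +_ (ℕ.suc-pred (m !)))))) ⟩
  mkℚᵘ (+ 1) 0                      ≈⟨ toℚᵘ-/ (+ 1) 1 ⟨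
  toℚᵘ 1ℚ                           ∎)
  where open ℚᵘ.≃-Reasoning
        instance _ = m !≢0

factRatio-suc : ∀ m j → factRatio (suc m) j ≡ ℕtoℚ (suc m) * factRatio m j
factRatio-suc m j = ℚ.toℚᵘ-injective (begin
  toℚᵘ (factRatio (suc m) j)                           ≈⟨ toℚᵘ-/ (+ (suc m !)) (j !) ⟩
  mkℚᵘ (+ (suc m !)) (ℕ.pred (j !))                     ≈⟨ *≡* (cong₂ ℤ._*_ (ℤ.pos-* (suc m) (m !))
                                                                            (cong +_ (ℕ.*-identityˡ _))) ⟩
  mkℚᵘ (+ suc m) 0 ℚᵘ.* mkℚᵘ (+ (m !)) (ℕ.pred (j !))
    ≈⟨ ℚᵘ.*-cong (toℚᵘ-/ (+ suc m) 1) (toℚᵘ-/ (+ (m !)) (j !)) ⟨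
  toℚᵘ (ℕtoℚ (suc m)) ℚᵘ.* toℚᵘ (factRatio m j)
    ≈⟨ ℚ.toℚᵘ-homo-* (ℕtoℚ (suc m)) (factRatio m j) ⟨
  toℚᵘ (ℕtoℚ (suc m) * factRatio m j)                  ∎)
  where open ℚᵘ.≃-Reasoning
        instance _ = j !≢0

∑ : {A : Set} → List A → (A → ℚ) → ℚ
∑ xs f = sumℚ (map f xs)

module _ {A : Set} where

  ∑-filter : ∀ {p} {P : Pred A p} (P? : Decidable P) (f : A → ℚ) xs →
             sumℚ (map f (filter P? xs)) ≡ ∑ xs (λ x → if does (P? x) then f x else 0ℚ)
  ∑-filter P? f []       = refl
  ∑-filter P? f (x ∷ xs) with does (P? x)
  ... | true  = cong (_+_ (f x)) (∑-filter P? f xs)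
  ... | false = trans (∑-filter P? f xs) (sym (ℚ.+-identityˡ _))

  ∑-cong : ∀ xs {f g : A → ℚ} → (∀ {x} → x ∈ xs → f x ≡ g x) → ∑ xs f ≡ ∑ xs g
  ∑-cong []       eq = refl
  ∑-cong (x ∷ xs) eq = cong₂ _+_ (eq (here refl)) (∑-cong xs (eq ∘ there))

  ∑-++ : ∀ xs ys (f : A → ℚ) → ∑ (xs ++ ys) f ≡ ∑ xs f + ∑ ys f
  ∑-++ []       ys f = sym (ℚ.+-identityˡ _)
  ∑-++ (x ∷ xs) ys f = trans (cong (_+_ (f x)) (∑-++ xs ys f)) (sym (ℚ.+-assoc (f x) _ _))

  ∑-∷ʳ : ∀ xs x (f : A → ℚ) → ∑ (xs ∷ʳ x) f ≡ ∑ xs f + f x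
  ∑-∷ʳ xs x f = trans (∑-++ xs [ x ] f) (cong (_+_ (∑ xs f)) (ℚ.+-identityʳ (f x)))

  ∑-↭ : ∀ {xs ys} (f : A → ℚ) → xs ↭ ys → ∑ xs f ≡ ∑ ys f
  ∑-↭ f p = foldr-commMonoid (≡.setoid ℚ) ℚ.+-0-isCommutativeMonoid (↭⇒↭ₛ (↭.map⁺ f p))

  *-distribˡ-∑ : ∀ c xs (f : A → ℚ) → c * ∑ xs f ≡ ∑ xs (λ x → c * f x)
  *-distribˡ-∑ c []       f = ℚ.*-zeroʳ c
  *-distribˡ-∑ c (x ∷ xs) f = trans (ℚ.*-distribˡ-+ c (f x) _) (cong (_+_ (c * f x)) (*-distribˡ-∑ c xs f))

  ∑-zero : ∀ xs → ∑ xs (λ (_ : A) → 0ℚ) ≡ 0ℚ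
  ∑-zero []       = refl
  ∑-zero (x ∷ xs) = trans (ℚ.+-identityˡ _) (∑-zero xs)

  ∑-const : ∀ xs c → ∑ xs (λ (_ : A) → c) ≡ ℕtoℚ (length xs) * c
  ∑-const []       c = sym (ℚ.*-zeroˡ c)
  ∑-const (x ∷ xs) c = begin
    c + ∑ xs (λ _ → c)              ≡⟨ cong₂ _+_ (ℚ.*-identityˡ c) (sym (∑-const xs c)) ⟨
    1ℚ * c + ℕtoℚ (length xs) * c  ≡⟨ ℚ.*-distribʳ-+ c 1ℚ (ℕtoℚ (length xs)) ⟨
    (1ℚ + ℕtoℚ (length xs)) * c    ≡⟨ cong (_* c) (ℕtoℚ-suc (length xs)) ⟨
    ℕtoℚ (suc (length xs)) * c     ∎
    where open ≡-Reasoning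

∑-map : ∀ {A B : Set} (g : A → B) xs (f : B → ℚ) → ∑ (map g xs) f ≡ ∑ xs (f ∘ g)
∑-map g []       f = refl
∑-map g (x ∷ xs) f = cong (_+_ (f (g x))) (∑-map g xs f)

∑-cartesianProductWith : ∀ {A B C : Set} (g : A → B → C) xs ys (f : C → ℚ) →
  ∑ (cartesianProductWith g xs ys) f ≡ ∑ xs (λ x → ∑ ys (f ∘ g x))
∑-cartesianProductWith g []       ys f = refl
∑-cartesianProductWith g (x ∷ xs) ys f =
  trans (∑-++ (map (g x) ys) _ f) (cong₂ _+_ (∑-map (g x) ys f) (∑-cartesianProductWith g xs ys f))

InRange : ℕ → ℕ → Set
InRange n x = 1 ≤ x × x ≤ n

record IsPermutation (n : ℕ) (π : List ℕ) : Set where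
  constructor isPermutation
  field
    length≡ : length π ≡ n
    inRange : All (InRange n) π
    unique  : Unique π

open IsPermutation

concatMap≡cartesianProductWith : ∀ {A B C : Set} (g : A → B → C) xs ys →
  concatMap (λ x → map (g x) ys) xs ≡ cartesianProductWith g xs ys
concatMap≡cartesianProductWith g []       ys = refl
concatMap≡cartesianProductWith g (x ∷ xs) ys = cong (map (g x) ys ++_) (concatMap≡cartesianProductWith g xs ys)

allLists-suc : ∀ N n → allLists N (suc n) ≡ cartesianProductWith (flip _∷_) (allLists N n) (allFin N)
allLists-suc N n = concatMap≡cartesianProductWith (flip _∷_) (allLists N n) (allFin N)

∈-allLists : ∀ {N} (xs : List (Fin N)) → xs ∈ allLists N (length xs)
∈-allLists []       = here refl
∈-allLists {N} (i ∷ xs) rewrite allLists-suc N (length xs) =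
  ∈-cartesianProductWith⁺ (flip _∷_) (∈-allLists xs) (∈-allFin i)

allLists-length : ∀ N n {xs} → xs ∈ allLists N n → length xs ≡ n
allLists-length N zero    (here refl) = refl
allLists-length N (suc n) xs∈ rewrite allLists-suc N n
  with _ , _ , ys∈ , _ , refl ← ∈-cartesianProductWith⁻ (flip _∷_) (allLists N n) (allFin N) xs∈ =
  cong suc (allLists-length N n ys∈)

allLists-unique : ∀ N n → Unique (allLists N n)
allLists-unique N zero    = [] ∷ []
allLists-unique N (suc n) rewrite allLists-suc N n =
  Unique.cartesianProductWith⁺ (flip _∷_) (swap ∘ List.∷-injective) (allLists-unique N n) (Unique.allFin⁺ N)

suc∘toℕ-injective : ∀ {N} → Injective _≡_ _≡_ (suc ∘ toℕ {N})
suc∘toℕ-injective = Fin.toℕ-injective ∘ ℕ.suc-injective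

oneLine-injective : ∀ {N} → Injective _≡_ _≡_ (oneLine {N})
oneLine-injective = List.map-injective suc∘toℕ-injective

𝔖-unique : ∀ N → Unique (𝔖 N)
𝔖-unique N = Unique.map⁺ oneLine-injective (Unique.filter⁺ (unique? Fin._≟_) (allLists-unique N N))

∈𝔖⇒isPermutation : ∀ {N π} → π ∈ 𝔖 N → IsPermutation N π
∈𝔖⇒isPermutation {N} π∈ with xs , xs∈ , refl ← ∈-map⁻ oneLine π∈
  with xs∈allLists , xs-unique ← ∈-filter⁻ (unique? Fin._≟_) xs∈ =
  isPermutation (trans (List.length-map _ xs) (allLists-length N N xs∈allLists))
                (All.map⁺ (All.universal (λ i → s≤s z≤n , Fin.toℕ<n i) xs))
                (Unique.map⁺ suc∘toℕ-injective xs-unique)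

toFins : ∀ {N} π → All (InRange N) π → List (Fin N)
toFins []          []                  = []
toFins (suc x ∷ π) ((_ , x<N) ∷ inRng) = fromℕ< x<N ∷ toFins π inRng

oneLine-toFins : ∀ {N} π (inRng : All (InRange N) π) → oneLine (toFins π inRng) ≡ π
oneLine-toFins []          []                  = refl
oneLine-toFins (suc x ∷ π) ((_ , x<N) ∷ inRng) =
  cong₂ _∷_ (cong suc (Fin.toℕ-fromℕ< x<N)) (oneLine-toFins π inRng)

isPermutation⇒∈𝔖 : ∀ {N π} → IsPermutation N π → π ∈ 𝔖 N
isPermutation⇒∈𝔖 {N} {π} p = subst (_∈ 𝔖 N) (oneLine-toFins π (inRange p))
  (∈-map⁺ oneLine (∈-filter⁺ (unique? Fin._≟_) xs∈allLists xs-unique))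
  where
  xs = toFins π (inRange p)
  length-xs : length xs ≡ N
  length-xs = trans (sym (List.length-map _ xs)) (trans (cong length (oneLine-toFins π (inRange p))) (length≡ p))
  xs∈allLists : xs ∈ allLists N N
  xs∈allLists = subst (xs ∈_) (cong (allLists N) length-xs) (∈-allLists xs)
  xs-unique : Unique xs
  xs-unique = Unique.map⁻ (subst Unique (sym (oneLine-toFins π (inRange p))) (unique p))

<ᵇ-true : ∀ {m n} → m < n → (m <ᵇ n) ≡ true
<ᵇ-true {m} {n} m<n with m <ᵇ n | ℕ.<ᵇ-reflects-< m n
... | true  | _       = refl
... | false | ofⁿ m≮n = ⊥-elim (m≮n m<n)

<ᵇ-false : ∀ {m n} → n ≤ m → (m <ᵇ n) ≡ false
<ᵇ-false {m} {n} n≤m with m <ᵇ n | ℕ.<ᵇ-reflects-< m n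
... | false | _       = refl
... | true  | ofʸ m<n = ⊥-elim (ℕ.<⇒≱ m<n n≤m)

bump : ℕ → ℕ → ℕ
bump v x = if x <ᵇ v then x else suc x

unbump : ℕ → ℕ → ℕ
unbump v x = if v <ᵇ x then ℕ.pred x else x

bump-< : ∀ {v x} → x < v → bump v x ≡ x
bump-< x<v rewrite <ᵇ-true x<v = refl

bump-≥ : ∀ {v x} → v ≤ x → bump v x ≡ suc x
bump-≥ v≤x rewrite <ᵇ-false v≤x = refl

bump-≢ : ∀ v x → bump v x ≢ v
bump-≢ v x with x <ᵇ v | ℕ.<ᵇ-reflects-< x v
... | true  | ofʸ x<v = ℕ.<⇒≢ x<v
... | false | ofⁿ x≮v = λ { refl → x≮v ℕ.≤-refl }

bump-<ᵇ : ∀ v a b → (bump v a <ᵇ bump v b) ≡ (a <ᵇ b)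
bump-<ᵇ v a b with a <ᵇ v | ℕ.<ᵇ-reflects-< a v | b <ᵇ v | ℕ.<ᵇ-reflects-< b v
... | true  | _       | true  | _       = refl
... | false | _       | false | _       = refl
... | true  | ofʸ a<v | false | ofⁿ b≮v =
  let a<b = ℕ.<-≤-trans a<v (ℕ.≮⇒≥ b≮v)
  in trans (<ᵇ-true (ℕ.m<n⇒m<1+n a<b)) (sym (<ᵇ-true a<b))
... | false | ofⁿ a≮v | true  | ofʸ b<v =
  let b≤a = ℕ.≤-trans (ℕ.<⇒≤ b<v) (ℕ.≮⇒≥ a≮v)
  in trans (<ᵇ-false (ℕ.m≤n⇒m≤1+n b≤a)) (sym (<ᵇ-false b≤a))

<ᵇ≡true⇒< : ∀ {m n} → (m <ᵇ n) ≡ true → m < n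
<ᵇ≡true⇒< {m} {n} eq = ℕ.<ᵇ⇒< m n (subst T (sym eq) tt)

bump-mono-< : ∀ v {a b} → a < b → bump v a < bump v b
bump-mono-< v {a} {b} a<b = <ᵇ≡true⇒< (trans (bump-<ᵇ v a b) (<ᵇ-true a<b))

bump-injective : ∀ v → Injective _≡_ _≡_ (bump v)
bump-injective v {a} {b} eq with ℕ.<-cmp a b
... | tri< a<b _ _ = ⊥-elim (ℕ.<-irrefl eq (bump-mono-< v a<b))
... | tri≈ _ a≡b _ = a≡b
... | tri> _ _ b<a = ⊥-elim (ℕ.<-irrefl (sym eq) (bump-mono-< v b<a))

bump-inRange : ∀ {n} v {x} → InRange n x → InRange (suc n) (bump v x)
bump-inRange v {x} (1≤x , x≤n) with x <ᵇ v
... | true  = 1≤x , ℕ.m≤n⇒m≤1+n x≤n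
... | false = s≤s z≤n , s≤s x≤n

unbump-inRange : ∀ {n v x} → InRange (suc n) v → InRange (suc n) x → x ≢ v → InRange n (unbump v x)
unbump-inRange {n} {v} {x} (1≤v , v≤1+n) (1≤x , x≤1+n) x≢v with v <ᵇ x | ℕ.<ᵇ-reflects-< v x
... | true  | ofʸ v<x = ℕ.<⇒≤pred (ℕ.≤-<-trans 1≤v v<x) , ℕ.pred-mono-≤ x≤1+n
... | false | ofⁿ v≮x = 1≤x , ℕ.≤-pred (ℕ.≤-trans (ℕ.≤∧≢⇒< (ℕ.≮⇒≥ v≮x) x≢v) v≤1+n)

bump-unbump : ∀ {v x} → x ≢ v → bump v (unbump v x) ≡ x
bump-unbump {v} {x} x≢v with v <ᵇ x | ℕ.<ᵇ-reflects-< v x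
... | true  | ofʸ v<x@(s≤s _) = bump-≥ (ℕ.≤-pred v<x)
... | false | ofⁿ v≮x         = bump-< (ℕ.≤∧≢⇒< (ℕ.≮⇒≥ v≮x) x≢v)

length-∷ʳ : ∀ {A : Set} (xs : List A) {x} → length (xs ∷ʳ x) ≡ suc (length xs)
length-∷ʳ xs = trans (List.length-++ xs) (ℕ.+-comm _ 1)

unique-∷ʳ⁻ : ∀ {A : Set} xs {x : A} → Unique (xs ∷ʳ x) → Unique xs × All (_≢ x) xs
unique-∷ʳ⁻ []       _          = [] , []
unique-∷ʳ⁻ (y ∷ xs) (y∉ ∷ uniq) with uniq′ , ≢x ← unique-∷ʳ⁻ xs uniq =
  All.++⁻ˡ xs y∉ ∷ uniq′ , All.head (All.++⁻ʳ xs y∉) ∷ ≢x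

insertLast : ℕ → List ℕ → List ℕ
insertLast v σ = map (bump v) σ ∷ʳ v

insertLast-injective : ∀ {v w σ τ} → insertLast v σ ≡ insertLast w τ → v ≡ w × σ ≡ τ
insertLast-injective {v} {σ = σ} {τ} eq with List.∷ʳ-injective (map (bump v) σ) _ eq
... | bumped≡ , refl = refl , List.map-injective (bump-injective v) bumped≡

insertLast-isPermutation : ∀ {n v σ} → InRange (suc n) v → IsPermutation n σ →
                           IsPermutation (suc n) (insertLast v σ)
insertLast-isPermutation {n} {v} {σ} v∈ p = isPermutation
  (trans (length-∷ʳ (map (bump v) σ)) (cong suc (trans (List.length-map _ σ) (length≡ p))))
  (All.++⁺ (All.map⁺ (All.map (bump-inRange v) (inRange p))) (v∈ ∷ []))
  (Unique.++⁺ (Unique.map⁺ (bump-injective v) (unique p)) ([] ∷ []) v∉bumped)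
  where
  v∉bumped : ∀ {x} → ¬ (x ∈ map (bump v) σ × x ∈ [ v ])
  v∉bumped (x∈ , here refl) with y , _ , v≡ ← ∈-map⁻ (bump v) x∈ = bump-≢ v y (sym v≡)

isPermutation-insertLast⁻ : ∀ {n π} → IsPermutation (suc n) π →
  ∃₂ λ v σ → InRange (suc n) v × IsPermutation n σ × π ≡ insertLast v σ
isPermutation-insertLast⁻ {π = π} p with initLast π
isPermutation-insertLast⁻ (isPermutation () _ _) | []
isPermutation-insertLast⁻ {n} (isPermutation len inRng uniq) | ys ∷ʳ′ v
  with ys-inRange , v∈ ∷ [] ← All.++⁻ ys inRng
     | ys-unique , ys≢v ← unique-∷ʳ⁻ ys uniq =
  v , map (unbump v) ys , v∈ ,
  isPermutation
    (trans (List.length-map _ ys) (ℕ.suc-injective (trans (sym (length-∷ʳ ys)) len)))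
    (All.map⁺ (All.zipWith (λ (x∈ , x≢v) → unbump-inRange v∈ x∈ x≢v) (ys-inRange , ys≢v)))
    (Unique.map⁻ (subst Unique (sym bump∘unbump) ys-unique))
  , cong (_∷ʳ v) (sym bump∘unbump)
  where
  bump∘unbump : map (bump v) (map (unbump v) ys) ≡ ys
  bump∘unbump = trans (sym (List.map-∘ ys)) (List.map-id-local (All.map bump-unbump ys≢v))

max-∈ : ∀ n {π} → IsPermutation (suc n) π → suc n ∈ π
max-∈-insertLast : ∀ n {v σ} → InRange (suc n) v → IsPermutation n σ → suc n ∈ insertLast v σ

max-∈ n p with v , σ , v∈ , σ-perm , refl ← isPermutation-insertLast⁻ p = max-∈-insertLast n v∈ σ-perm

max-∈-insertLast n {v} {σ} (1≤v , v≤1+n) σ-perm with ℕ.m≤n⇒m<n∨m≡n v≤1+n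
... | inj₂ refl = ∈-++⁺ʳ (map (bump v) σ) (here refl)
max-∈-insertLast (suc n) {v} {σ} _ σ-perm | inj₁ (s≤s v≤1+n) =
  ∈-++⁺ˡ (subst (_∈ map (bump v) σ) (bump-≥ v≤1+n) (∈-map⁺ (bump v) (max-∈ n σ-perm)))
max-∈-insertLast zero (() , _) _ | inj₁ (s≤s z≤n)

insertLast-max : ∀ {n σ} → IsPermutation n σ → insertLast (suc n) σ ≡ σ ∷ʳ suc n
insertLast-max {n} p =
  cong (_∷ʳ suc n) (List.map-id-local (All.map (λ (_ , x≤n) → bump-< (s≤s x≤n)) (inRange p)))

∈-applyUpTo-suc⁺ : ∀ {n v} → InRange n v → v ∈ applyUpTo suc n
∈-applyUpTo-suc⁺ {v = suc i} (_ , i<n) = ∈-applyUpTo⁺ suc i<n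

∈-applyUpTo-suc⁻ : ∀ {n v} → v ∈ applyUpTo suc n → InRange n v
∈-applyUpTo-suc⁻ v∈ with i , i<n , refl ← ∈-applyUpTo⁻ suc v∈ = s≤s z≤n , i<n

𝔖-suc↭ : ∀ n → 𝔖 (suc n) ↭ cartesianProductWith insertLast (applyUpTo suc (suc n)) (𝔖 n)
𝔖-suc↭ n = ∼bag⇒↭ (unique∧set⇒bag (𝔖-unique (suc n)) insertions-unique (mk⇔ decompose compose))
  where
  insertions = cartesianProductWith insertLast (applyUpTo suc (suc n)) (𝔖 n)

  insertions-unique : Unique insertions
  insertions-unique = Unique.cartesianProductWith⁺ insertLast insertLast-injective
    (Unique.applyUpTo⁺₁ suc (suc n) (λ i<j _ → ℕ.<⇒≢ (s≤s i<j))) (𝔖-unique n)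

  decompose : ∀ {π} → π ∈ 𝔖 (suc n) → π ∈ insertions
  decompose π∈ with v , σ , v∈ , σ-perm , refl ← isPermutation-insertLast⁻ (∈𝔖⇒isPermutation π∈) =
    ∈-cartesianProductWith⁺ insertLast (∈-applyUpTo-suc⁺ v∈) (isPermutation⇒∈𝔖 σ-perm)

  compose : ∀ {π} → π ∈ insertions → π ∈ 𝔖 (suc n)
  compose π∈ with v , σ , v∈ , σ∈ , refl ← ∈-cartesianProductWith⁻ insertLast _ (𝔖 n) π∈ =
    isPermutation⇒∈𝔖 (insertLast-isPermutation (∈-applyUpTo-suc⁻ v∈) (∈𝔖⇒isPermutation σ∈))

∑𝔖-suc : ∀ n (f g h : List ℕ → ℚ) →
  (∀ {v σ} → InRange n v → σ ∈ 𝔖 n → f (insertLast v σ) ≡ g σ) →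
  (∀ {σ} → σ ∈ 𝔖 n → f (σ ∷ʳ suc n) ≡ h σ) →
  ∑ (𝔖 (suc n)) f ≡ ℕtoℚ n * ∑ (𝔖 n) g + ∑ (𝔖 n) h
∑𝔖-suc n f g h below top = begin
  ∑ (𝔖 (suc n)) f
    ≡⟨ ∑-↭ f (𝔖-suc↭ n) ⟩
  ∑ (cartesianProductWith insertLast (applyUpTo suc (suc n)) (𝔖 n)) f
    ≡⟨ ∑-cartesianProductWith insertLast (applyUpTo suc (suc n)) (𝔖 n) f ⟩
  ∑ (applyUpTo suc (suc n)) (λ v → ∑ (𝔖 n) (f ∘ insertLast v))
    ≡⟨ cong (λ vs → ∑ vs (λ v → ∑ (𝔖 n) (f ∘ insertLast v))) (List.applyUpTo-∷ʳ suc n) ⟨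
  ∑ (applyUpTo suc n ∷ʳ suc n) (λ v → ∑ (𝔖 n) (f ∘ insertLast v))
    ≡⟨ ∑-∷ʳ (applyUpTo suc n) (suc n) _ ⟩
  ∑ (applyUpTo suc n) (λ v → ∑ (𝔖 n) (f ∘ insertLast v)) + ∑ (𝔖 n) (f ∘ insertLast (suc n))
    ≡⟨ cong₂ _+_
         (∑-cong (applyUpTo suc n) (λ v∈ → ∑-cong (𝔖 n) (below (∈-applyUpTo-suc⁻ v∈))))
         (∑-cong (𝔖 n) (λ σ∈ → trans (cong f (insertLast-max (∈𝔖⇒isPermutation σ∈))) (top σ∈))) ⟩
  ∑ (applyUpTo suc n) (λ _ → ∑ (𝔖 n) g) + ∑ (𝔖 n) h
    ≡⟨ cong (_+ ∑ (𝔖 n) h) (∑-const (applyUpTo suc n) _) ⟩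
  ℕtoℚ (length (applyUpTo suc n)) * ∑ (𝔖 n) g + ∑ (𝔖 n) h
    ≡⟨ cong (λ m → ℕtoℚ m * ∑ (𝔖 n) g + ∑ (𝔖 n) h) (List.length-applyUpTo suc n) ⟩
  ℕtoℚ n * ∑ (𝔖 n) g + ∑ (𝔖 n) h
    ∎
  where open ≡-Reasoning

runningMax : ℕ → List ℕ → ℕ
runningMax m []       = m
runningMax m (x ∷ xs) = if m <ᵇ x then runningMax x xs else runningMax m xs

lrmFlags-++ : ∀ m xs ys → lrmFlags m (xs ++ ys) ≡ lrmFlags m xs ++ lrmFlags (runningMax m xs) ys
lrmFlags-++ m []       ys = refl
lrmFlags-++ m (x ∷ xs) ys with m <ᵇ x
... | true  = cong (true ∷_) (lrmFlags-++ x xs ys)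
... | false = cong (false ∷_) (lrmFlags-++ m xs ys)

lrmFlags-[_] : ∀ m y → lrmFlags m [ y ] ≡ [ m <ᵇ y ]
lrmFlags-[_] m y with m <ᵇ y
... | true  = refl
... | false = refl

lrmFlags-∷ʳ : ∀ m xs y → lrmFlags m (xs ∷ʳ y) ≡ lrmFlags m xs ∷ʳ (runningMax m xs <ᵇ y)
lrmFlags-∷ʳ m xs y = trans (lrmFlags-++ m xs [ y ]) (cong (lrmFlags m xs ++_) (lrmFlags-[_] (runningMax m xs) y))

length-lrmFlags : ∀ m xs → length (lrmFlags m xs) ≡ length xs
length-lrmFlags m []       = refl
length-lrmFlags m (x ∷ xs) with m <ᵇ x
... | true  = cong suc (length-lrmFlags x xs)
... | false = cong suc (length-lrmFlags m xs)

≤-runningMax : ∀ m xs → m ≤ runningMax m xs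
≤-runningMax m []       = ℕ.≤-refl
≤-runningMax m (x ∷ xs) with m <ᵇ x | ℕ.<ᵇ-reflects-< m x
... | true  | ofʸ m<x = ℕ.≤-trans (ℕ.<⇒≤ m<x) (≤-runningMax x xs)
... | false | _       = ≤-runningMax m xs

∈⇒≤-runningMax : ∀ m {xs y} → y ∈ xs → y ≤ runningMax m xs
∈⇒≤-runningMax m {x ∷ xs} y∈ with m <ᵇ x | ℕ.<ᵇ-reflects-< m x | y∈
... | true  | _       | here refl = ≤-runningMax x xs
... | true  | _       | there y∈′ = ∈⇒≤-runningMax x y∈′
... | false | ofⁿ m≮x | here refl = ℕ.≤-trans (ℕ.≮⇒≥ m≮x) (≤-runningMax m xs)
... | false | _       | there y∈′ = ∈⇒≤-runningMax m y∈′

runningMax-≤ : ∀ {m b} xs → m ≤ b → All (_≤ b) xs → runningMax m xs ≤ b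
runningMax-≤ []               m≤b []          = m≤b
runningMax-≤ {m} (x ∷ xs) m≤b (x≤b ∷ xs≤b) with m <ᵇ x
... | true  = runningMax-≤ xs x≤b xs≤b
... | false = runningMax-≤ xs m≤b xs≤b

countFlags : ℕ → List Bool → ℕ
countFlags = foldr (λ b n → if b then suc n else n)

countFlags-suc : ∀ k bs → countFlags (suc k) bs ≡ suc (countFlags k bs)
countFlags-suc k []           = refl
countFlags-suc k (true ∷ bs)  = cong suc (countFlags-suc k bs)
countFlags-suc k (false ∷ bs) = countFlags-suc k bs

lrm-∷ʳ : ∀ xs y → lrm (xs ∷ʳ y) ≡ countFlags (if runningMax 0 xs <ᵇ y then 1 else 0) (lrmFlags 0 xs)
lrm-∷ʳ xs y = trans (cong (countFlags 0) (lrmFlags-∷ʳ 0 xs y)) (List.foldr-∷ʳ _ 0 _ (lrmFlags 0 xs))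

lrm-∷ʳ-record : ∀ xs {y} → runningMax 0 xs < y → lrm (xs ∷ʳ y) ≡ suc (lrm xs)
lrm-∷ʳ-record xs {y} max<y = trans (lrm-∷ʳ xs y)
  (trans (cong (λ b → countFlags (if b then 1 else 0) (lrmFlags 0 xs)) (<ᵇ-true max<y))
         (countFlags-suc 0 (lrmFlags 0 xs)))

lrm-∷ʳ-nonRecord : ∀ xs {y} → y ≤ runningMax 0 xs → lrm (xs ∷ʳ y) ≡ lrm xs
lrm-∷ʳ-nonRecord xs {y} y≤max = trans (lrm-∷ʳ xs y)
  (cong (λ b → countFlags (if b then 1 else 0) (lrmFlags 0 xs)) (<ᵇ-false y≤max))

firstFlagged-map : ∀ (f : ℕ → ℕ) xs bs → firstFlagged (map f xs) bs ≡ Maybe.map f (firstFlagged xs bs)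
firstFlagged-map f []       bs           = refl
firstFlagged-map f (x ∷ xs) []           = refl
firstFlagged-map f (x ∷ xs) (true ∷ bs)  = refl
firstFlagged-map f (x ∷ xs) (false ∷ bs) = firstFlagged-map f xs bs

firstFlagged-∈ : ∀ xs bs {x} → firstFlagged xs bs ≡ just x → x ∈ xs
firstFlagged-∈ (y ∷ xs) (true ∷ bs)  refl = here refl
firstFlagged-∈ (y ∷ xs) (false ∷ bs) eq   = there (firstFlagged-∈ xs bs eq)

firstFlagged-∷ʳ : ∀ xs bs y b → length xs ≡ length bs →
  firstFlagged (xs ∷ʳ y) (bs ∷ʳ b) ≡ firstFlagged xs bs <∣> (if b then just y else nothing)
firstFlagged-∷ʳ []       []           y true  _   = refl
firstFlagged-∷ʳ []       []           y false _   = refl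
firstFlagged-∷ʳ (x ∷ xs) (true ∷ bs)  y b     _   = refl
firstFlagged-∷ʳ (x ∷ xs) (false ∷ bs) y b     len = firstFlagged-∷ʳ xs bs y b (ℕ.suc-injective len)

drop-∷ʳ : ∀ {A : Set} k (xs : List A) y → k ≤ length xs → drop k (xs ∷ʳ y) ≡ drop k xs ∷ʳ y
drop-∷ʳ zero    xs       y _         = refl
drop-∷ʳ (suc k) (x ∷ xs) y (s≤s k≤n) = drop-∷ʳ k xs y k≤n

strategy-∷ʳ : ∀ k xs y → k ≤ length xs →
  strategy k (xs ∷ʳ y) ≡ strategy k xs <∣> (if runningMax 0 xs <ᵇ y then just y else nothing)
strategy-∷ʳ k xs y k≤n = begin
  firstFlagged (drop k (xs ∷ʳ y)) (drop k (lrmFlags 0 (xs ∷ʳ y)))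
    ≡⟨ cong₂ firstFlagged (drop-∷ʳ k xs y k≤n)
                          (trans (cong (drop k) (lrmFlags-∷ʳ 0 xs y)) (drop-∷ʳ k (lrmFlags 0 xs) _ k≤#flags)) ⟩
  firstFlagged (drop k xs ∷ʳ y) (drop k (lrmFlags 0 xs) ∷ʳ (runningMax 0 xs <ᵇ y))
    ≡⟨ firstFlagged-∷ʳ (drop k xs) (drop k (lrmFlags 0 xs)) y _ length-drops ⟩
  strategy k xs <∣> (if runningMax 0 xs <ᵇ y then just y else nothing)
    ∎
  where
  open ≡-Reasoning
  k≤#flags : k ≤ length (lrmFlags 0 xs)
  k≤#flags = subst (k ≤_) (sym (length-lrmFlags 0 xs)) k≤n
  length-drops : length (drop k xs) ≡ length (drop k (lrmFlags 0 xs))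
  length-drops = trans (List.length-drop k xs)
                       (sym (trans (List.length-drop k _) (cong (_∸ k) (length-lrmFlags 0 xs))))

strategy-∷ʳ-record : ∀ k xs {y} → k ≤ length xs → runningMax 0 xs < y →
                     strategy k (xs ∷ʳ y) ≡ strategy k xs <∣> just y
strategy-∷ʳ-record k xs {y} k≤n max<y =
  trans (strategy-∷ʳ k xs y k≤n)
        (cong (λ b → strategy k xs <∣> (if b then just y else nothing)) (<ᵇ-true max<y))

strategy-∷ʳ-nonRecord : ∀ k xs {y} → k ≤ length xs → y ≤ runningMax 0 xs →
                        strategy k (xs ∷ʳ y) ≡ strategy k xs
strategy-∷ʳ-nonRecord k xs {y} k≤n y≤max = trans (strategy-∷ʳ k xs y k≤n)
  (trans (cong (λ b → strategy k xs <∣> (if b then just y else nothing)) (<ᵇ-false y≤max))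
         (Maybe.<∣>-identityʳ _))

strategy-All : ∀ {P : Pred ℕ 0ℓ} k {xs x} → All P xs → strategy k xs ≡ just x → P x
strategy-All k {xs} pxs eq = All.lookup (All.drop⁺ k pxs) (firstFlagged-∈ (drop k xs) _ eq)

module _ {f : ℕ → ℕ} (f-<ᵇ : ∀ a b → (f a <ᵇ f b) ≡ (a <ᵇ b)) (f-0 : f 0 ≡ 0) where

  lrmFlags-map : ∀ m xs → lrmFlags (f m) (map f xs) ≡ lrmFlags m xs
  lrmFlags-map m []       = refl
  lrmFlags-map m (x ∷ xs) rewrite f-<ᵇ m x with m <ᵇ x
  ... | true  = cong (true ∷_) (lrmFlags-map x xs)
  ... | false = cong (false ∷_) (lrmFlags-map m xs)

  lrmFlags₀-map : ∀ xs → lrmFlags 0 (map f xs) ≡ lrmFlags 0 xs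
  lrmFlags₀-map xs = subst (λ m → lrmFlags m (map f xs) ≡ lrmFlags 0 xs) f-0 (lrmFlags-map 0 xs)

  lrm-map : ∀ xs → lrm (map f xs) ≡ lrm xs
  lrm-map xs = cong (countFlags 0) (lrmFlags₀-map xs)

  strategy-map : ∀ k xs → strategy k (map f xs) ≡ Maybe.map f (strategy k xs)
  strategy-map k xs = trans (cong₂ firstFlagged (List.drop-map k xs) (cong (drop k) (lrmFlags₀-map xs)))
                            (firstFlagged-map f (drop k xs) (drop k (lrmFlags 0 xs)))

bumped-nonRecord : ∀ {n v σ} → IsPermutation n σ → InRange n v → v ≤ runningMax 0 (map (bump v) σ)
bumped-nonRecord {zero}  _ (1≤v , v≤0) = ⊥-elim (ℕ.<-irrefl refl (ℕ.≤-trans 1≤v v≤0))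
bumped-nonRecord {suc n} {v} {σ} p (_ , v≤1+n) = ℕ.≤-trans (ℕ.m≤n⇒m≤1+n v≤1+n)
  (∈⇒≤-runningMax 0 (subst (_∈ map (bump v) σ) (bump-≥ v≤1+n) (∈-map⁺ (bump v) (max-∈ n p))))

runningMax<1+n : ∀ {n σ} → IsPermutation n σ → runningMax 0 σ < suc n
runningMax<1+n {σ = σ} p = s≤s (runningMax-≤ σ z≤n (All.map proj₂ (inRange p)))

module _ {n σ} (p : IsPermutation n σ) where

  strategy-insertLast : ∀ {v} k → k ≤ n → InRange n v →
                        strategy k (insertLast v σ) ≡ Maybe.map (bump v) (strategy k σ)
  strategy-insertLast {v} k k≤n v∈@(1≤v , _) =
    trans (strategy-∷ʳ-nonRecord k (map (bump v) σ) k≤length (bumped-nonRecord p v∈))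
          (strategy-map (bump-<ᵇ v) (bump-< 1≤v) k σ)
    where
    k≤length : k ≤ length (map (bump v) σ)
    k≤length = subst (k ≤_) (sym (trans (List.length-map _ σ) (length≡ p))) k≤n

  lrm-insertLast : ∀ {v} → InRange n v → lrm (insertLast v σ) ≡ lrm σ
  lrm-insertLast {v} v∈@(1≤v , _) =
    trans (lrm-∷ʳ-nonRecord (map (bump v) σ) (bumped-nonRecord p v∈)) (lrm-map (bump-<ᵇ v) (bump-< 1≤v) σ)

  strategy-∷ʳ-max : ∀ k → k ≤ n → strategy k (σ ∷ʳ suc n) ≡ strategy k σ <∣> just (suc n)
  strategy-∷ʳ-max k k≤n = strategy-∷ʳ-record k σ (subst (k ≤_) (sym (length≡ p)) k≤n) (runningMax<1+n p)

  lrm-∷ʳ-max : lrm (σ ∷ʳ suc n) ≡ suc (lrm σ)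
  lrm-∷ʳ-max = lrm-∷ʳ-record σ (runningMax<1+n p)

  strategy-≤ : ∀ k {x} → strategy k σ ≡ just x → x ≤ n
  strategy-≤ k = strategy-All k (All.map proj₂ (inRange p))

strategy-beyond-length : ∀ k xs → length xs ≤ k → strategy k xs ≡ nothing
strategy-beyond-length k xs len≤k =
  cong (λ ys → firstFlagged ys (drop k (lrmFlags 0 xs))) (List.drop-all k xs len≤k)

strategy-𝔖-nothing : ∀ k {σ} → σ ∈ 𝔖 k → strategy k σ ≡ nothing
strategy-𝔖-nothing k σ∈ = strategy-beyond-length k _ (ℕ.≤-reflexive (length≡ (∈𝔖⇒isPermutation σ∈)))

-- Stated via ≡-dec so that does (winnable? N k π) is selects N (strategy k π) by definition.
selects : ℕ → Maybe ℕ → Bool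
selects N s = does (Maybe.≡-dec _≟_ s (just N))

selects-map : ∀ {f} → Injective _≡_ _≡_ f → ∀ a s → selects (f a) (Maybe.map f s) ≡ selects a s
selects-map {f} f-inj a s =
  does-⇔ (mk⇔ (Maybe.map-injective f-inj) (cong (Maybe.map f)))
         (Maybe.≡-dec _≟_ (Maybe.map f s) (just (f a))) (Maybe.≡-dec _≟_ s (just a))

selects-<∣>-just : ∀ {a} s → (∀ {x} → s ≡ just x → x ≢ a) → selects a (s <∣> just a) ≡ is-nothing s
selects-<∣>-just {a} nothing  _   = dec-true (Maybe.≡-dec _≟_ (just a) (just a)) refl
selects-<∣>-just {a} (just x) x≢a =
  dec-false (Maybe.≡-dec _≟_ (just x) (just a)) (x≢a refl ∘ Maybe.just-injective)

is-nothing-map : ∀ (f : ℕ → ℕ) s → is-nothing (Maybe.map f s) ≡ is-nothing s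
is-nothing-map f nothing  = refl
is-nothing-map f (just x) = refl

is-nothing-<∣>-just : ∀ (s : Maybe ℕ) a → is-nothing (s <∣> just a) ≡ false
is-nothing-<∣>-just nothing  a = refl
is-nothing-<∣>-just (just x) a = refl

module _ (θ : ℚ) where

  weightIf : Bool → ℕ → ℚ
  weightIf b l = if b then θ ^ℚ l else 0ℚ

  weightIf-suc : ∀ b l → weightIf b (suc l) ≡ θ * weightIf b l
  weightIf-suc true  l = refl
  weightIf-suc false l = sym (ℚ.*-zeroʳ θ)

  weight : List ℕ → ℚ
  weight π = θ ^ℚ lrm π

  weightWin : ℕ → ℕ → List ℕ → ℚ
  weightWin N k π = weightIf (selects N (strategy k π)) (lrm π)

  weightNone : ℕ → List ℕ → ℚ
  weightNone k π = weightIf (is-nothing (strategy k π)) (lrm π)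

  winningWeight : ℕ → ℕ → ℚ
  winningWeight N k = ∑ (𝔖 N) (weightWin N k)

  -- noSelectionWeight n k = A(n,k) and totalWeight n = T(n).
  noSelectionWeight : ℕ → ℕ → ℚ
  noSelectionWeight n k = ∑ (𝔖 n) (weightNone k)

  totalWeight : ℕ → ℚ
  totalWeight n = ∑ (𝔖 n) weight

  W≡winningWeight : ∀ N k → W θ N k ≡ winningWeight N k
  W≡winningWeight N k = ∑-filter (winnable? N k) weight (𝔖 N)

  winningWeight-suc : ∀ n {k} → k ≤ n →
    winningWeight (suc n) k ≡ ℕtoℚ n * winningWeight n k + θ * noSelectionWeight n k
  winningWeight-suc n {k} k≤n = trans (∑𝔖-suc n _ _ _ below top)
    (cong (_+_ (ℕtoℚ n * winningWeight n k)) (sym (*-distribˡ-∑ θ (𝔖 n) (weightNone k))))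
    where
    below : ∀ {v σ} → InRange n v → σ ∈ 𝔖 n → weightWin (suc n) k (insertLast v σ) ≡ weightWin n k σ
    below {v} {σ} v∈@(_ , v≤n) σ∈ = cong₂ weightIf
      (begin
        selects (suc n) (strategy k (insertLast v σ))
          ≡⟨ cong (selects (suc n)) (strategy-insertLast p k k≤n v∈) ⟩
        selects (suc n) (Maybe.map (bump v) (strategy k σ))
          ≡⟨ cong (λ a → selects a (Maybe.map (bump v) (strategy k σ))) (bump-≥ v≤n) ⟨
        selects (bump v n) (Maybe.map (bump v) (strategy k σ))
          ≡⟨ selects-map (bump-injective v) n (strategy k σ) ⟩
        selects n (strategy k σ)
          ∎)
      (lrm-insertLast p v∈)
      where p = ∈𝔖⇒isPermutation σ∈
            open ≡-Reasoning
    top : ∀ {σ} → σ ∈ 𝔖 n → weightWin (suc n) k (σ ∷ʳ suc n) ≡ θ * weightNone k σ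
    top {σ} σ∈ = trans (cong₂ weightIf selects-max (lrm-∷ʳ-max p)) (weightIf-suc _ (lrm σ))
      where
      p = ∈𝔖⇒isPermutation σ∈
      selects-max : selects (suc n) (strategy k (σ ∷ʳ suc n)) ≡ is-nothing (strategy k σ)
      selects-max = trans (cong (selects (suc n)) (strategy-∷ʳ-max p k k≤n))
                          (selects-<∣>-just (strategy k σ) (λ eq → ℕ.<⇒≢ (s≤s (strategy-≤ p k eq))))

  noSelectionWeight-suc : ∀ n {k} → k ≤ n → noSelectionWeight (suc n) k ≡ ℕtoℚ n * noSelectionWeight n k
  noSelectionWeight-suc n {k} k≤n = trans (∑𝔖-suc n _ _ (λ _ → 0ℚ) below top)
    (trans (cong (_+_ (ℕtoℚ n * noSelectionWeight n k)) (∑-zero (𝔖 n))) (ℚ.+-identityʳ _))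
    where
    below : ∀ {v σ} → InRange n v → σ ∈ 𝔖 n → weightNone k (insertLast v σ) ≡ weightNone k σ
    below {v} {σ} v∈ σ∈ = cong₂ weightIf
      (trans (cong is-nothing (strategy-insertLast p k k≤n v∈)) (is-nothing-map (bump v) (strategy k σ)))
      (lrm-insertLast p v∈)
      where p = ∈𝔖⇒isPermutation σ∈
    top : ∀ {σ} → σ ∈ 𝔖 n → weightNone k (σ ∷ʳ suc n) ≡ 0ℚ
    top {σ} σ∈ = cong (λ b → weightIf b (lrm (σ ∷ʳ suc n)))
      (trans (cong is-nothing (strategy-∷ʳ-max (∈𝔖⇒isPermutation σ∈) k k≤n))
             (is-nothing-<∣>-just (strategy k σ) (suc n)))

  totalWeight-suc : ∀ n → totalWeight (suc n) ≡ ℕtoℚ n * totalWeight n + θ * totalWeight n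
  totalWeight-suc n = trans (∑𝔖-suc n _ _ _ below top)
    (cong (_+_ (ℕtoℚ n * totalWeight n)) (sym (*-distribˡ-∑ θ (𝔖 n) weight)))
    where
    below : ∀ {v σ} → InRange n v → σ ∈ 𝔖 n → weight (insertLast v σ) ≡ weight σ
    below v∈ σ∈ = cong (θ ^ℚ_) (lrm-insertLast (∈𝔖⇒isPermutation σ∈) v∈)
    top : ∀ {σ} → σ ∈ 𝔖 n → weight (σ ∷ʳ suc n) ≡ θ * weight σ
    top σ∈ = cong (θ ^ℚ_) (lrm-∷ʳ-max (∈𝔖⇒isPermutation σ∈))

  noSelectionWeight-self : ∀ k → noSelectionWeight k k ≡ totalWeight k
  noSelectionWeight-self k = ∑-cong (𝔖 k) λ {σ} σ∈ →
    cong (λ s → weightIf (is-nothing s) (lrm σ)) (strategy-𝔖-nothing k σ∈)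

  totalWeight≡rising : ∀ n → totalWeight n ≡ rising θ n
  totalWeight≡rising zero    = ℚ.+-identityʳ 1ℚ
  totalWeight≡rising (suc n) = begin
    totalWeight (suc n)                         ≡⟨ totalWeight-suc n ⟩
    ℕtoℚ n * totalWeight n + θ * totalWeight n  ≡⟨ ℚ.*-distribʳ-+ (totalWeight n) (ℕtoℚ n) θ ⟨
    (ℕtoℚ n + θ) * totalWeight n               ≡⟨ ℚ.*-comm _ (totalWeight n) ⟩
    totalWeight n * (ℕtoℚ n + θ)               ≡⟨ cong₂ _*_ (totalWeight≡rising n) (ℚ.+-comm _ θ) ⟩
    rising θ n * (θ + ℕtoℚ n)                  ∎
    where open ≡-Reasoning

  noSelectionWeight-zero : ∀ n → noSelectionWeight (suc n) 0 ≡ 0ℚ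
  noSelectionWeight-zero zero    = trans (noSelectionWeight-suc 0 z≤n) (ℚ.*-zeroˡ (noSelectionWeight 0 0))
  noSelectionWeight-zero (suc n) = begin
    noSelectionWeight (suc (suc n)) 0          ≡⟨ noSelectionWeight-suc (suc n) z≤n ⟩
    ℕtoℚ (suc n) * noSelectionWeight (suc n) 0 ≡⟨ cong (ℕtoℚ (suc n) *_) (noSelectionWeight-zero n) ⟩
    ℕtoℚ (suc n) * 0ℚ                         ≡⟨ ℚ.*-zeroʳ (ℕtoℚ (suc n)) ⟩
    0ℚ                                        ∎
    where open ≡-Reasoning

  noSelectionWeight≡ : ∀ {j m} → j ≤′ m →
                       noSelectionWeight (suc m) (suc j) ≡ factRatio m j * rising θ (suc j)
  noSelectionWeight≡ {j} ≤′-refl = begin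
    noSelectionWeight (suc j) (suc j)  ≡⟨ noSelectionWeight-self (suc j) ⟩
    totalWeight (suc j)                ≡⟨ totalWeight≡rising (suc j) ⟩
    rising θ (suc j)                   ≡⟨ ℚ.*-identityˡ _ ⟨
    1ℚ * rising θ (suc j)              ≡⟨ cong (_* rising θ (suc j)) (factRatio-self j) ⟨
    factRatio j j * rising θ (suc j)   ∎
    where open ≡-Reasoning
  noSelectionWeight≡ {j} (≤′-step {m} j≤′m) = begin
    noSelectionWeight (suc (suc m)) (suc j)
      ≡⟨ noSelectionWeight-suc (suc m) (s≤s (ℕ.≤′⇒≤ j≤′m)) ⟩
    ℕtoℚ (suc m) * noSelectionWeight (suc m) (suc j)
      ≡⟨ cong (ℕtoℚ (suc m) *_) (noSelectionWeight≡ j≤′m) ⟩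
    ℕtoℚ (suc m) * (factRatio m j * rising θ (suc j))
      ≡⟨ ℚ.*-assoc (ℕtoℚ (suc m)) (factRatio m j) (rising θ (suc j)) ⟨
    ℕtoℚ (suc m) * factRatio m j * rising θ (suc j)
      ≡⟨ cong (_* rising θ (suc j)) (factRatio-suc m j) ⟨
    factRatio (suc m) j * rising θ (suc j)
      ∎
    where open ≡-Reasoning

  W-suc : ∀ n {k} → k ≤ n → W θ (suc n) k ≡ ℕtoℚ n * W θ n k + θ * noSelectionWeight n k
  W-suc n {k} k≤n = begin
    W θ (suc n) k                                          ≡⟨ W≡winningWeight (suc n) k ⟩
    winningWeight (suc n) k                                ≡⟨ winningWeight-suc n k≤n ⟩
    ℕtoℚ n * winningWeight n k + θ * noSelectionWeight n k
      ≡⟨ cong (λ w → ℕtoℚ n * w + θ * noSelectionWeight n k) (W≡winningWeight n k) ⟨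
    ℕtoℚ n * W θ n k + θ * noSelectionWeight n k           ∎
    where open ≡-Reasoning

  W-self : ∀ N → W θ N N ≡ 0ℚ
  W-self N = begin
    W θ N N                                               ≡⟨ W≡winningWeight N N ⟩
    ∑ (𝔖 N) (weightWin N N)
      ≡⟨ ∑-cong (𝔖 N) (λ {σ} σ∈ → cong (λ s → weightIf (selects N s) (lrm σ)) (strategy-𝔖-nothing N σ∈)) ⟩
    ∑ (𝔖 N) (λ _ → 0ℚ)                                    ≡⟨ ∑-zero (𝔖 N) ⟩
    0ℚ                                                    ∎
    where open ≡-Reasoning

  W-1-0 : W θ 1 0 ≡ θ
  W-1-0 = begin
    W θ 1 0                                    ≡⟨ W-suc 0 z≤n ⟩
    0ℚ * W θ 0 0 + θ * noSelectionWeight 0 0   ≡⟨ cong (_+ θ * noSelectionWeight 0 0) (ℚ.*-zeroˡ (W θ 0 0)) ⟩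
    0ℚ + θ * noSelectionWeight 0 0             ≡⟨ ℚ.+-identityˡ _ ⟩
    θ * noSelectionWeight 0 0                  ≡⟨ cong (θ *_) (trans (noSelectionWeight-self 0) (totalWeight≡rising 0)) ⟩
    θ * 1ℚ                                     ≡⟨ ℚ.*-identityʳ θ ⟩
    θ                                          ∎
    where open ≡-Reasoning

  W-suc-zero : ∀ n → W θ (suc (suc n)) 0 ≡ ℕtoℚ (suc n) * W θ (suc n) 0
  W-suc-zero n = begin
    W θ (suc (suc n)) 0                                                 ≡⟨ W-suc (suc n) z≤n ⟩
    ℕtoℚ (suc n) * W θ (suc n) 0 + θ * noSelectionWeight (suc n) 0
      ≡⟨ cong (λ a → ℕtoℚ (suc n) * W θ (suc n) 0 + θ * a) (noSelectionWeight-zero n) ⟩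
    ℕtoℚ (suc n) * W θ (suc n) 0 + θ * 0ℚ
      ≡⟨ cong (_+_ (ℕtoℚ (suc n) * W θ (suc n) 0)) (ℚ.*-zeroʳ θ) ⟩
    ℕtoℚ (suc n) * W θ (suc n) 0 + 0ℚ                                   ≡⟨ ℚ.+-identityʳ _ ⟩
    ℕtoℚ (suc n) * W θ (suc n) 0                                        ∎
    where open ≡-Reasoning

  W-suc-suc : ∀ {j m} → j ≤ m →
    W θ (suc (suc m)) (suc j) ≡ ℕtoℚ (suc m) * W θ (suc m) (suc j) + factRatio m j * θ * rising θ (suc j)
  W-suc-suc {j} {m} j≤m = trans (W-suc (suc m) (s≤s j≤m))
    (cong (_+_ (ℕtoℚ (suc m) * W θ (suc m) (suc j))) (begin
      θ * noSelectionWeight (suc m) (suc j)   ≡⟨ cong (θ *_) (noSelectionWeight≡ (ℕ.≤⇒≤′ j≤m)) ⟩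
      θ * (factRatio m j * rising θ (suc j))  ≡⟨ ℚ.*-assoc θ (factRatio m j) (rising θ (suc j)) ⟨
      θ * factRatio m j * rising θ (suc j)    ≡⟨ cong (_* rising θ (suc j)) (ℚ.*-comm θ (factRatio m j)) ⟩
      factRatio m j * θ * rising θ (suc j)    ∎))
    where open ≡-Reasoning

theorem4p3 : (θ : ℚ) → 0ℚ Data.Rational.< θ →
    (W θ 1 0 ≡ θ)
    × (∀ (N : ℕ) → 1 ≤ N → W θ N N ≡ 0ℚ)
    × (∀ (N k : ℕ) → 2 ≤ N → k Data.Nat.< N → k ≡ 0 →
        W θ N k ≡ ℕtoℚ (N ∸ 1) * W θ (N ∸ 1) k)
    × (∀ (N k : ℕ) → 2 ≤ N → k Data.Nat.< N → 1 ≤ k →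
        W θ N k ≡ ℕtoℚ (N ∸ 1) * W θ (N ∸ 1) k + factRatio (N ∸ 2) (k ∸ 1) * θ * rising θ k)
theorem4p3 θ _ = W-1-0 θ , (λ N _ → W-self θ N) , k≡0 , k≥1
  where
  k≡0 : ∀ N k → 2 ≤ N → k Data.Nat.< N → k ≡ 0 → W θ N k ≡ ℕtoℚ (N ∸ 1) * W θ (N ∸ 1) k
  k≡0 (suc zero)    _ (s≤s ()) _ _
  k≡0 (suc (suc n)) _ _        _ refl = W-suc-zero θ n

  k≥1 : ∀ N k → 2 ≤ N → k Data.Nat.< N → 1 ≤ k →
    W θ N k ≡ ℕtoℚ (N ∸ 1) * W θ (N ∸ 1) k + factRatio (N ∸ 2) (k ∸ 1) * θ * rising θ k
  k≥1 (suc zero)    _       (s≤s ())        _ _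
  k≥1 (suc (suc m)) zero    _ _             ()
  k≥1 (suc (suc m)) (suc j) _ (s≤s (s≤s j≤m)) _ = W-suc-suc θ j≤m
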